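{- Let $k\ge 1$ be an integer, let $p<q$ be odd primes, and let $n=2^kpq$. If $\sigma(n)-2n=2^{k+1}$, then $n$ is weird.
   Context: $\sigma(n)$ denotes the sum of all positive divisors of $n$. A natural number $n$ is abundant if $\sigma(n)>2n$. The aliquot parts of $n$ are the positive divisors $d$ of $n$ with $d<n$. An abundant number $n$ is pseudoperfect if $n$ equals the sum of the elements of some subset of the aliquot parts of $n$ (each aliquot part used at most once). A natural number $n$ is weird if it is abundant but not pseudoperfect. -}

module Defs where

open import Data.Nat using (ℕ; suc; _+_; _*_; _<_; _>_)
open import Data.Nat.Divisibility using (_∣_; _∣?_)
open import Data.Nat.ListAction using (sum)
open import Data.List using (List; filter; upTo; map)
open import Data.List.Relation.Binary.Sublist.Propositional using (_⊆_)
open import Data.Product using (∃; _×_)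
open import Relation.Binary.PropositionalEquality using (_≡_)
open import Relation.Nullary using (¬_)

divisors : ℕ → List ℕ
divisors n = filter (_∣? n) (map suc (upTo n))

aliquotParts : ℕ → List ℕ
aliquotParts n = filter (_∣? n) (map suc (upTo (n Data.Nat.∸ 1)))

σ : ℕ → ℕ
σ n = sum (divisors n)

Abundant : ℕ → Set
Abundant n = σ n > 2 * n

-- a subset of the aliquot parts (the list has no duplicates, so sublists
-- correspond exactly to subsets, each element used at most once)
Pseudoperfect : ℕ → Set
Pseudoperfect n = Abundant n × ∃ λ (S : List ℕ) → (S ⊆ aliquotParts n) × (sum S ≡ n)

Weird : ℕ → Set
Weird n = Abundant n × ¬ Pseudoperfect n

module Submission where

-- Let n = 2^k p q and D = 2^(k+1), so the hypothesis reads σ(n) = 2n + D.  For weirdness, suppose a set S of aliquot parts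
-- sums to n.  All aliquot parts together sum to σ(n) - n = n + D, so the
-- complementary set C of aliquot parts sums to D; in particular d ≤ D for
-- every d ∈ C.  Next, D < p: the distinct divisors 2^i pq, 2^i q, 2^i p
-- (i ≤ k) of n sum to (D - 1)(pq + q + p) ≤ σ(n) = D pq + D, which forces
-- D ≤ p once p ≥ 3, and D ≠ p since p is odd.  Hence no d ∈ C is divisible
-- by p or by q, so C consists of distinct powers 2^i with i ≤ k, and
-- ΣC ≤ 1 + 2 + ⋯ + 2^k = D - 1 < D, a contradiction.

open import Defs
open import Data.Nat using (ℕ; zero; suc; _+_; _*_; _^_; _≤_; _<_; _∸_; z≤n; s≤s; z<s)
open import Data.Nat.Base using (>-nonZero; nonTrivial⇒n>1)
open import Data.Nat.Properties
open import Data.Nat.Divisibility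
open import Data.Nat.Primality using (Prime; prime⇒irreducible; prime⇒nonTrivial; prime[2])
open import Data.Nat.Coprimality using (Coprime; coprime-divisor)
open import Data.Nat.ListAction using (sum)
open import Data.Nat.ListAction.Properties using (sum-++)
open import Data.Nat.Tactic.RingSolver using (solve-∀)
open import Data.List using (List; []; _∷_; _++_; [_]; filter; upTo; map; applyUpTo)
open import Data.List.Properties using (upTo-∷ʳ; map-++; filter-++; filter-accept; applyUpTo-∷ʳ)
open import Data.List.Membership.Propositional using (_∈_)
open import Data.List.Membership.Propositional.Properties
  using (∈-∃++; ∈-++⁺ˡ; ∈-++⁺ʳ; ∈-++⁻; ∈-filter⁺; ∈-filter⁻; ∈-map⁺; ∈-map⁻; ∈-upTo⁺; ∈-applyUpTo⁺; ∈-applyUpTo⁻)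
open import Data.List.Relation.Unary.All using (All; []; _∷_; tabulate)
import Data.List.Relation.Unary.All as All
import Data.List.Relation.Unary.All.Properties as AllProperties
open import Data.List.Relation.Unary.Any using (here; there)
open import Data.List.Relation.Unary.AllPairs using ([]; _∷_)
open import Data.List.Relation.Unary.Unique.Propositional using (Unique)
import Data.List.Relation.Unary.Unique.Propositional.Properties as Unique
open import Data.List.Relation.Binary.Disjoint.Propositional using (Disjoint)
open import Data.List.Relation.Binary.Sublist.Propositional using (_⊆_; []; _∷ʳ_; _∷_)
open import Data.List.Relation.Binary.Sublist.Propositional.Properties using (All-resp-⊆; Any-resp-⊆)
open import Data.Product using (∃; _×_; _,_)
open import Data.Sum using (inj₁; inj₂)
open import Data.Empty using (⊥; ⊥-elim)
open import Relation.Binary.PropositionalEquality hiding ([_])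
open import Relation.Nullary using (¬_; Dec; yes; no)

∈⇒≤sum : ∀ {x} {xs : List ℕ} → x ∈ xs → x ≤ sum xs
∈⇒≤sum {xs = y ∷ ys} (here refl) = m≤m+n y (sum ys)
∈⇒≤sum {xs = y ∷ ys} (there x∈ys) = ≤-trans (∈⇒≤sum x∈ys) (m≤n+m (sum ys) y)

-- A duplicate-free list all of whose elements occur in ys has sum at most
-- sum ys: each element of xs consumes a distinct occurrence in ys.
Unique⇒sum≤ : ∀ {xs ys : List ℕ} → Unique xs → All (_∈ ys) xs → sum xs ≤ sum ys
Unique⇒sum≤ [] [] = z≤n
Unique⇒sum≤ {x ∷ xs} (x∉xs ∷ xs-unique) (x∈ys ∷ xs⊆ys) with ∈-∃++ x∈ys
... | as , bs , refl = begin
    x + sum xs             ≤⟨ +-monoʳ-≤ x (Unique⇒sum≤ xs-unique (remove x∉xs xs⊆ys)) ⟩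
    x + sum (as ++ bs)     ≡⟨ cong (x +_) (sum-++ as bs) ⟩
    x + (sum as + sum bs)  ≡⟨ swap x (sum as) (sum bs) ⟩
    sum as + (x + sum bs)  ≡⟨ sym (sum-++ as (x ∷ bs)) ⟩
    sum (as ++ x ∷ bs)     ∎
  where
  open ≤-Reasoning
  swap : ∀ a b c → a + (b + c) ≡ b + (a + c)
  swap = solve-∀
  -- the elements of xs avoid x, so they survive deleting x from ys
  remove : ∀ {zs} → All (x ≢_) zs → All (_∈ as ++ x ∷ bs) zs → All (_∈ as ++ bs) zs
  remove [] [] = []
  remove (x≢z ∷ x≢zs) (z∈ ∷ zs∈) with ∈-++⁻ as z∈
  ... | inj₁ z∈as         = ∈-++⁺ˡ z∈as ∷ remove x≢zs zs∈
  ... | inj₂ (here refl)  = ⊥-elim (x≢z refl)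
  ... | inj₂ (there z∈bs) = ∈-++⁺ʳ as z∈bs ∷ remove x≢zs zs∈

Unique-resp-⊆ : ∀ {a} {A : Set a} {xs ys : List A} → xs ⊆ ys → Unique ys → Unique xs
Unique-resp-⊆ [] [] = []
Unique-resp-⊆ (y ∷ʳ xs⊆ys) (_ ∷ ys-unique) = Unique-resp-⊆ xs⊆ys ys-unique
Unique-resp-⊆ (refl ∷ xs⊆ys) (y∉ys ∷ ys-unique) = All-resp-⊆ xs⊆ys y∉ys ∷ Unique-resp-⊆ xs⊆ys ys-unique

complement : ∀ {S L : List ℕ} → S ⊆ L → ∃ λ C → C ⊆ L × sum L ≡ sum S + sum C
complement [] = [] , [] , refl
complement {S} (y ∷ʳ S⊆L) with complement S⊆L
... | C , C⊆L , sumL≡ = y ∷ C , refl ∷ C⊆L , trans (cong (y +_) sumL≡) (swap y (sum S) (sum C))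
  where
  swap : ∀ a b c → a + (b + c) ≡ b + (a + c)
  swap = solve-∀
complement {x ∷ S} (refl ∷ S⊆L) with complement S⊆L
... | C , C⊆L , sumL≡ = C , x ∷ʳ C⊆L , trans (cong (x +_) sumL≡) (sym (+-assoc x (sum S) (sum C)))

σ≡aliquot+n : ∀ n → 0 < n → σ n ≡ sum (aliquotParts n) + n
σ≡aliquot+n (suc m) _ = begin
  sum (filter ∣n? (map suc (upTo (suc m))))
    ≡⟨ cong (λ l → sum (filter ∣n? (map suc l))) (sym (upTo-∷ʳ m)) ⟩
  sum (filter ∣n? (map suc (upTo m ++ [ m ])))
    ≡⟨ cong (λ l → sum (filter ∣n? l)) (map-++ suc (upTo m) [ m ]) ⟩
  sum (filter ∣n? (map suc (upTo m) ++ [ suc m ]))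
    ≡⟨ cong sum (filter-++ ∣n? (map suc (upTo m)) [ suc m ]) ⟩
  sum (A ++ filter ∣n? [ suc m ])
    ≡⟨ cong (λ l → sum (A ++ l)) (filter-accept ∣n? ∣-refl) ⟩
  sum (A ++ [ suc m ])
    ≡⟨ sum-++ A [ suc m ] ⟩
  sum A + (suc m + 0)
    ≡⟨ cong (sum A +_) (+-identityʳ (suc m)) ⟩
  sum A + suc m ∎
  where
  open ≡-Reasoning
  ∣n? : (d : ℕ) → Dec (d ∣ suc m)
  ∣n? = _∣? suc m
  A : List ℕ
  A = filter ∣n? (map suc (upTo m))

aliquotParts-Unique : ∀ n → Unique (aliquotParts n)
aliquotParts-Unique n = Unique.filter⁺ (_∣? n) (Unique.map⁺ suc-injective (Unique.upTo⁺ (n ∸ 1)))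

∈aliquotParts⇒∣ : ∀ {d n} → d ∈ aliquotParts n → d ∣ n × 0 < d
∈aliquotParts⇒∣ {d} {n} d∈ with ∈-filter⁻ (_∣? n) {xs = map suc (upTo (n ∸ 1))} d∈
... | d∈suc[upTo] , d∣n with ∈-map⁻ suc d∈suc[upTo]
... | _ , _ , refl = d∣n , s≤s z≤n

∣⇒∈divisors : ∀ {d n} → d ∣ n → 0 < n → d ∈ divisors n
∣⇒∈divisors {zero} {n} d∣n 0<n with 0∣⇒≡0 d∣n
∣⇒∈divisors {zero} {.0} d∣n () | refl
∣⇒∈divisors {suc d} {suc n} d∣n _ = ∈-filter⁺ (_∣? suc n) (∈-map⁺ suc (∈-upTo⁺ (∣⇒≤ d∣n))) d∣n

excess⇒Abundant : ∀ {n e} → 0 < e → σ n ≡ 2 * n + e → Abundant n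
excess⇒Abundant {n} 0<e σn≡ = subst (2 * n <_) (sym σn≡) (m<m+n (2 * n) 0<e)

excess-complement : ∀ {n e} {S : List ℕ} → 0 < n → σ n ≡ 2 * n + e
  → S ⊆ aliquotParts n → sum S ≡ n → ∃ λ C → C ⊆ aliquotParts n × sum C ≡ e
excess-complement {n} {e} {S} 0<n σn≡ S⊆ sumS≡n with complement S⊆
... | C , C⊆ , sum≡ = C , C⊆ , +-cancelˡ-≡ (n + n) (sum C) e (begin
  n + n + sum C                     ≡⟨ rearrange n (sum C) ⟩
  n + sum C + n                     ≡⟨ cong (λ s → s + sum C + n) (sym sumS≡n) ⟩
  sum S + sum C + n                 ≡⟨ cong (_+ n) (sym sum≡) ⟩
  sum (aliquotParts n) + n          ≡⟨ sym (σ≡aliquot+n n 0<n) ⟩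
  σ n                               ≡⟨ σn≡ ⟩
  2 * n + e                         ≡⟨ double n e ⟩
  n + n + e                         ∎)
  where
  open ≡-Reasoning
  rearrange : ∀ a b → a + a + b ≡ a + b + a
  rearrange = solve-∀
  double : ∀ a b → 2 * a + b ≡ a + a + b
  double = solve-∀

doublings : ℕ → ℕ → List ℕ
doublings m c = applyUpTo (λ i → 2 ^ i * c) m

doublings-sum : ∀ m c → sum (doublings m c) + c ≡ 2 ^ m * c
doublings-sum zero c = sym (+-identityʳ c)
doublings-sum (suc m) c = begin
  sum (doublings (suc m) c) + c             ≡⟨ cong (λ l → sum l + c) (sym (applyUpTo-∷ʳ f m)) ⟩
  sum (doublings m c ++ [ f m ]) + c         ≡⟨ cong (_+ c) (sum-++ (doublings m c) [ f m ]) ⟩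
  sum (doublings m c) + (f m + 0) + c        ≡⟨ rearrange (sum (doublings m c)) (f m) c ⟩
  (sum (doublings m c) + c) + f m            ≡⟨ cong (_+ f m) (doublings-sum m c) ⟩
  2 ^ m * c + 2 ^ m * c                      ≡⟨ double (2 ^ m) c ⟩
  2 ^ suc m * c                              ∎
  where
  open ≡-Reasoning
  f : ℕ → ℕ
  f i = 2 ^ i * c
  rearrange : ∀ s x c → s + (x + 0) + c ≡ s + c + x
  rearrange = solve-∀
  double : ∀ x c → x * c + x * c ≡ 2 * x * c
  double = solve-∀

doublings-Unique : ∀ m {c} → 0 < c → Unique (doublings m c)
doublings-Unique m {c} 0<c = Unique.applyUpTo⁺₁ _ m (λ i<j _ eq →
  <-irrefl eq (*-monoˡ-< c {{>-nonZero 0<c}} (^-monoʳ-< 2 (s≤s (s≤s z≤n)) i<j)))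

Unique⊆doublings⇒sum< : ∀ m {C : List ℕ} → Unique C → All (_∈ doublings m 1) C → sum C < 2 ^ m
Unique⊆doublings⇒sum< m {C} C-unique C⊆ = begin-strict
  sum C                    ≤⟨ Unique⇒sum≤ C-unique C⊆ ⟩
  sum (doublings m 1)      <⟨ m<m+n (sum (doublings m 1)) (s≤s z≤n) ⟩
  sum (doublings m 1) + 1  ≡⟨ doublings-sum m 1 ⟩
  2 ^ m * 1                ≡⟨ *-identityʳ (2 ^ m) ⟩
  2 ^ m                    ∎
  where open ≤-Reasoning

*-positive : ∀ {a b} → 0 < a → 0 < b → 0 < a * b
*-positive {suc a} {suc b} _ _ = z<s

prime⇒1< : ∀ {r} → Prime r → 1 < r
prime⇒1< {r} r-prime = nonTrivial⇒n>1 r {{prime⇒nonTrivial r-prime}}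

odd-prime⇒3≤ : ∀ {r} → Prime r → ¬ 2 ∣ r → 3 ≤ r
odd-prime⇒3≤ {r} r-prime r-odd with prime⇒1< r-prime
... | s≤s (s≤s {n = suc _} _) = s≤s (s≤s (s≤s z≤n))
... | s≤s (s≤s {n = zero} _) = ⊥-elim (r-odd ∣-refl)

∤prime⇒coprime : ∀ {r d} → Prime r → ¬ r ∣ d → Coprime d r
∤prime⇒coprime r-prime r∤d (i∣d , i∣r) with prime⇒irreducible r-prime i∣r
... | inj₁ refl = refl
... | inj₂ refl = ⊥-elim (r∤d i∣d)

∤prime⇒∣cancel : ∀ {r d m} → Prime r → ¬ r ∣ d → d ∣ r * m → d ∣ m
∤prime⇒∣cancel r-prime r∤d = coprime-divisor (∤prime⇒coprime r-prime r∤d)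

odd-∣2^*⇒∣ : ∀ {r} → ¬ 2 ∣ r → ∀ j c → r ∣ 2 ^ j * c → r ∣ c
odd-∣2^*⇒∣ {r} r-odd zero c r∣ = subst (r ∣_) (+-identityʳ c) r∣
odd-∣2^*⇒∣ {r} r-odd (suc j) c r∣ =
  odd-∣2^*⇒∣ r-odd j c (∤prime⇒∣cancel prime[2] r-odd (subst (r ∣_) (*-assoc 2 (2 ^ j) c) r∣))

doublings-Disjoint : ∀ {r c₁ c₂} m₁ m₂ → ¬ 2 ∣ r → r ∣ c₁ → ¬ r ∣ c₂
  → Disjoint (doublings m₁ c₁) (doublings m₂ c₂)
doublings-Disjoint {r} {c₁} {c₂} _ _ r-odd r∣c₁ r∤c₂ (v∈₁ , v∈₂)
  with ∈-applyUpTo⁻ (λ i → 2 ^ i * c₁) v∈₁ | ∈-applyUpTo⁻ (λ i → 2 ^ i * c₂) v∈₂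
... | i , _ , refl | j , _ , eq = r∤c₂ (odd-∣2^*⇒∣ r-odd j c₂ (subst (r ∣_) eq (∣n⇒∣m*n (2 ^ i) r∣c₁)))

doublings-∣ : ∀ k {c a} → c ∣ a → All (_∣ 2 ^ k * a) (doublings (suc k) c)
doublings-∣ k c∣a = AllProperties.applyUpTo⁺₁ _ (suc k) (λ i<1+k → *-pres-∣ (2^i∣2^k i<1+k) c∣a)
  where
  2^i∣2^k : ∀ {i} → i < suc k → 2 ^ i ∣ 2 ^ k
  2^i∣2^k {i} (s≤s i≤k) with m≤n⇒∃[o]m+o≡n i≤k
  ... | t , refl = subst (2 ^ i ∣_) (sym (^-distribˡ-+-* 2 i t)) (m∣m*n (2 ^ t))

∣2^⇒power : ∀ k {d} → d ∣ 2 ^ k → ∃ λ i → i ≤ k × d ≡ 2 ^ i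
∣2^⇒power zero d∣1 = 0 , z≤n , ∣1⇒≡1 d∣1
∣2^⇒power (suc k) {d} d∣2^[1+k] with 2 ∣? d
... | no d-odd with ∣2^⇒power k (∤prime⇒∣cancel prime[2] d-odd d∣2^[1+k])
...   | i , i≤k , d≡2^i = i , m≤n⇒m≤1+n i≤k , d≡2^i
∣2^⇒power (suc k) d∣2^[1+k] | yes (divides e refl)
  with ∣2^⇒power k {e} (*-cancelʳ-∣ 2 (subst (e * 2 ∣_) (*-comm 2 (2 ^ k)) d∣2^[1+k]))
... | i , i≤k , refl = suc i , s≤s i≤k , *-comm (2 ^ i) 2

power∈doublings : ∀ {i k} → i ≤ k → 2 ^ i ∈ doublings (suc k) 1
power∈doublings {i} i≤k = subst (_∈ _) (*-identityʳ (2 ^ i)) (∈-applyUpTo⁺ (λ i → 2 ^ i * 1) (s≤s i≤k))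

∤primes⇒∣ : ∀ {a p q d} → Prime p → Prime q → d ∣ a * p * q → ¬ p ∣ d → ¬ q ∣ d → d ∣ a
∤primes⇒∣ {a} {p} {q} {d} p-prime q-prime d∣apq p∤d q∤d =
  ∤prime⇒∣cancel p-prime p∤d (subst (d ∣_) (*-comm a p)
    (∤prime⇒∣cancel q-prime q∤d (subst (d ∣_) (*-comm (a * p) q) d∣apq)))

-- p² > p + 1 for p ≥ 3, since p² ≥ 3p.
1+p<p² : ∀ {p} → 3 ≤ p → suc p < p * p
1+p<p² {p@(suc (suc (suc p′)))} 3≤p@(s≤s (s≤s (s≤s _))) = begin-strict
  suc p                    <⟨ m≤m+n (5 + p′) (4 + p′ + p′) ⟩
  5 + p′ + (4 + p′ + p′)   ≡⟨ triple p′ ⟩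
  3 * p                    ≤⟨ *-monoˡ-≤ p 3≤p ⟩
  p * p                    ∎
  where
  open ≤-Reasoning
  triple : ∀ x → 5 + x + (4 + x + x) ≡ 3 * (3 + x)
  triple = solve-∀

-- If D (q + p) ≤ D + pq + q + p with p ≥ 3 and q ≥ 1, then D ≤ p.  Writing
-- D = p + 1 + t, the hypothesis reduces to t q + p² + t p ≤ p + 1 + t,
-- which fails because p² > p + 1 and t q ≥ t.
excess-bound⇒≤ : ∀ D p q → 3 ≤ p → 1 ≤ q → D * q + D * p ≤ D + (p * q + q + p) → D ≤ p
excess-bound⇒≤ D p q 3≤p 1≤q bound = ≮⇒≥ p≮D
  where
  open ≤-Reasoning
  expand : ∀ a b t → (suc a + t) * b + (suc a + t) * a ≡ (t * b + a * a + t * a) + (a * b + b + a)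
  expand = solve-∀
  p≮D : ¬ p < D
  p≮D p<D with m≤n⇒∃[o]m+o≡n p<D
  ... | t , refl = <⇒≱ small (+-cancelʳ-≤ (p * q + q + p) _ _ (subst (_≤ suc p + t + (p * q + q + p)) (expand p q t) bound))
    where
    small : suc p + t < t * q + p * p + t * p
    small = begin-strict
      suc p + t              ≡⟨ +-comm (suc p) t ⟩
      t + suc p              <⟨ +-mono-≤-< (m≤m*n t q {{>-nonZero 1≤q}}) (1+p<p² 3≤p) ⟩
      t * q + p * p          ≤⟨ m≤m+n (t * q + p * p) (t * p) ⟩
      t * q + p * p + t * p  ∎

module _ {k p q : ℕ} (p-prime : Prime p) (q-prime : Prime q)
         (p-odd : ¬ 2 ∣ p) (q-odd : ¬ 2 ∣ q) (p<q : p < q) where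

  private
    n : ℕ
    n = 2 ^ k * p * q

    D : ℕ
    D = 2 ^ suc k

    0<p : 0 < p
    0<p = <-trans z<s (prime⇒1< p-prime)

    0<q : 0 < q
    0<q = <-trans z<s (prime⇒1< q-prime)

    0<n : 0 < n
    0<n = *-positive (*-positive (m^n>0 2 k) 0<p) 0<q

    q∤p : ¬ q ∣ p
    q∤p = >⇒∤ {{>-nonZero 0<p}} p<q

    p∤q : ¬ p ∣ q
    p∤q p∣q with prime⇒irreducible q-prime p∣q
    ... | inj₁ refl = <-irrefl refl (prime⇒1< p-prime)
    ... | inj₂ refl = <-irrefl refl p<q

  blocks : List ℕ
  blocks = doublings (suc k) (p * q) ++ (doublings (suc k) q ++ doublings (suc k) p)

  -- They are pairwise distinct: p separates the pq-block from the q-block,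
  -- q separates the p-block from the other two.
  blocks-Unique : Unique blocks
  blocks-Unique = Unique.++⁺ (doublings-Unique (suc k) (*-positive 0<p 0<q))
    (Unique.++⁺ (doublings-Unique (suc k) 0<q) (doublings-Unique (suc k) 0<p)
      (doublings-Disjoint (suc k) (suc k) q-odd ∣-refl q∤p))
    λ (v∈pq , v∈q++p) → case-split v∈pq v∈q++p
    where
    case-split : ∀ {v} → v ∈ doublings (suc k) (p * q) → v ∈ doublings (suc k) q ++ doublings (suc k) p → ⊥
    case-split v∈pq v∈q++p with ∈-++⁻ (doublings (suc k) q) v∈q++p
    ... | inj₁ v∈q = doublings-Disjoint (suc k) (suc k) p-odd (m∣m*n q) p∤q (v∈pq , v∈q)
    ... | inj₂ v∈p = doublings-Disjoint (suc k) (suc k) q-odd (n∣m*n p) q∤p (v∈pq , v∈p)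

  blocks-∈divisors : All (_∈ divisors n) blocks
  blocks-∈divisors = AllProperties.++⁺ (divisors-of (p * q) ∣-refl)
    (AllProperties.++⁺ (divisors-of q (n∣m*n p)) (divisors-of p (m∣m*n q)))
    where
    divisors-of : ∀ c → c ∣ p * q → All (_∈ divisors n) (doublings (suc k) c)
    divisors-of c c∣pq = All.map (λ {d} d∣ → ∣⇒∈divisors (subst (d ∣_) (sym (*-assoc (2 ^ k) p q)) d∣) 0<n)
      (doublings-∣ k c∣pq)

  blocks-sum : sum blocks + (p * q + q + p) ≡ D * (p * q) + (D * q + D * p)
  blocks-sum = begin
    sum blocks + (p * q + q + p)
      ≡⟨ cong (_+ (p * q + q + p)) (trans (sum-++ A (B ++ C)) (cong (sum A +_) (sum-++ B C))) ⟩
    sum A + (sum B + sum C) + (p * q + q + p)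
      ≡⟨ regroup (sum A) (sum B) (sum C) (p * q) q p ⟩
    (sum A + p * q) + ((sum B + q) + (sum C + p))
      ≡⟨ cong₂ _+_ (doublings-sum (suc k) (p * q)) (cong₂ _+_ (doublings-sum (suc k) q) (doublings-sum (suc k) p)) ⟩
    D * (p * q) + (D * q + D * p) ∎
    where
    open ≡-Reasoning
    A B C : List ℕ
    A = doublings (suc k) (p * q)
    B = doublings (suc k) q
    C = doublings (suc k) p
    regroup : ∀ a b c x y z → a + (b + c) + (x + y + z) ≡ (a + x) + ((b + y) + (c + z))
    regroup = solve-∀

  -- Comparing the blocks with σ(n) = D pq + D shows D < p.
  excess<p : σ n ≡ 2 * n + D → D < p
  excess<p σn≡ = ≤∧≢⇒< D≤p D≢p
    where
    open ≤-Reasoning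
    2n≡ : ∀ a b c → 2 * (a * b * c) ≡ 2 * a * (b * c)
    2n≡ = solve-∀
    reassoc : ∀ x y z w → x + y + (z + w) ≡ x + (y + (z + w))
    reassoc = solve-∀
    blocks≤σ : sum blocks ≤ D * (p * q) + D
    blocks≤σ = begin
      sum blocks         ≤⟨ Unique⇒sum≤ blocks-Unique blocks-∈divisors ⟩
      σ n                ≡⟨ σn≡ ⟩
      2 * n + D          ≡⟨ cong (_+ D) (2n≡ (2 ^ k) p q) ⟩
      D * (p * q) + D    ∎
    D≤p : D ≤ p
    D≤p = excess-bound⇒≤ D p q (odd-prime⇒3≤ p-prime p-odd) 0<q
      (+-cancelˡ-≤ (D * (p * q)) _ _ (begin
        D * (p * q) + (D * q + D * p)           ≡⟨ blocks-sum ⟨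
        sum blocks + (p * q + q + p)            ≤⟨ +-monoˡ-≤ (p * q + q + p) blocks≤σ ⟩
        D * (p * q) + D + (p * q + q + p)       ≡⟨ reassoc (D * (p * q)) D (p * q + q) p ⟩
        D * (p * q) + (D + (p * q + q + p))     ∎))
    D≢p : D ≢ p
    D≢p refl = p-odd (divides (2 ^ k) (*-comm 2 (2 ^ k)))

  -- An aliquot part of n below p is divisible by neither p nor q, hence a power of 2.
  small-aliquot⇒power : ∀ {d} → d ∈ aliquotParts n → d < p → d ∈ doublings (suc k) 1
  small-aliquot⇒power d∈ d<p with ∈aliquotParts⇒∣ d∈
  ... | d∣n , 0<d with ∣2^⇒power k (∤primes⇒∣ p-prime q-prime d∣n
                         (>⇒∤ {{>-nonZero 0<d}} d<p) (>⇒∤ {{>-nonZero 0<d}} (<-trans d<p p<q)))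
  ...   | i , i≤k , refl = power∈doublings i≤k

  -- The complement of a pseudoperfect witness would be a set of distinct
  -- powers 2^i (i ≤ k) summing to D, which is impossible.
  not-pseudoperfect : σ n ≡ 2 * n + D → ¬ Pseudoperfect n
  not-pseudoperfect σn≡ (_ , S , S⊆ , sumS≡n) with excess-complement 0<n σn≡ S⊆ sumS≡n
  ... | C , C⊆ , sumC≡D = <-irrefl sumC≡D (Unique⊆doublings⇒sum< (suc k) C-unique C-powers)
    where
    C-unique : Unique C
    C-unique = Unique-resp-⊆ C⊆ (aliquotParts-Unique n)
    C-powers : All (_∈ doublings (suc k) 1) C
    C-powers = tabulate λ d∈C → small-aliquot⇒power (Any-resp-⊆ C⊆ d∈C)
      (≤-<-trans (subst (_ ≤_) sumC≡D (∈⇒≤sum d∈C)) (excess<p σn≡))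

mainTheorem3 : (k p q : ℕ) → 1 ≤ k → Prime p → Prime q → ¬ (2 ∣ p) → ¬ (2 ∣ q) → p < q
    → σ (2 ^ k * p * q) ≡ 2 * (2 ^ k * p * q) + 2 ^ (k + 1)
    → Weird (2 ^ k * p * q)
mainTheorem3 k p q _ p-prime q-prime p-odd q-odd p<q σn≡ =
  excess⇒Abundant {2 ^ k * p * q} (m^n>0 2 (suc k)) σn≡′ , not-pseudoperfect {k} p-prime q-prime p-odd q-odd p<q σn≡′
  where
  σn≡′ : σ (2 ^ k * p * q) ≡ 2 * (2 ^ k * p * q) + 2 ^ suc k
  σn≡′ = subst (λ e → σ (2 ^ k * p * q) ≡ 2 * (2 ^ k * p * q) + 2 ^ e) (+-comm k 1) σn≡
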